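{- Let $r\ge1$ and $n\ge 2r+1$ be integers, and let $P_n$ be the path with vertices $x_1,\dots,x_n$ labeled consecutively. If $D$ is an $r$-identifying code of $P_n$, then $x_{r+2},x_{r+3},\dots,x_{2r+1}\in D$ and $x_{n-r-1},x_{n-r-2},\dots,x_{n-2r}\in D$.
   Context: For a graph $G=(V,E)$ and integer $r\ge1$, $d(x,y)$ is the number of edges in a shortest path between $x$ and $y$, $N_r[x]=\{y\in V: d(x,y)\le r\}$, and for $D\subseteq V$, $D_r(x)=N_r[x]\cap D$. A set $D\subseteq V$ is an $r$-identifying code of $G$ if $D_r(x)\neq\emptyset$ for every $x\in V$ and $D_r(x)\neq D_r(y)$ for all distinct $x,y\in V$. -}

module Defs where

open import Data.Nat using (ℕ; suc; _≤_; _<_; ∣_-_∣)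
open import Data.Fin using (Fin; toℕ)
open import Data.Fin.Subset using (Subset; _∈_)
open import Data.Product using (Σ; ∃; _×_)
open import Relation.Nullary using (¬_)
open import Function.Bundles using (_⇔_)
open import Relation.Binary.PropositionalEquality using (_≡_)

-- A graph given by its vertex set Fin n together with its shortest-path
-- distance function.  For the path P_n on vertices x_1,…,x_n (vertex x_k is
-- represented by index k-1 : Fin n), the shortest-path distance between
-- x_i and x_j is |i - j|.
pathDist : {n : ℕ} → Fin n → Fin n → ℕ
pathDist i j = ∣ toℕ i - toℕ j ∣

_∈Ball[_,_,_]_ : {n : ℕ} → Fin n → (Fin n → Fin n → ℕ) → ℕ → Subset n → Fin n → Set
z ∈Ball[ d , r , D ] x = (z ∈ D) × (d x z ≤ r)

IsIdentifyingCode : {n : ℕ} → (Fin n → Fin n → ℕ) → ℕ → Subset n → Set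
IsIdentifyingCode {n} d r D =
  ((x : Fin n) → ∃ λ z → z ∈Ball[ d , r , D ] x)
  × ((x y : Fin n) → ¬ (x ≡ y) →
       ¬ ((z : Fin n) → (z ∈Ball[ d , r , D ] x) ⇔ (z ∈Ball[ d , r , D ] y)))

IsPathIdCode : (n r : ℕ) → Subset n → Set
IsPathIdCode n r D = IsIdentifyingCode (pathDist {n}) r D

{-# OPTIONS --safe #-}
-- When the centre of an r-ball on the path moves from x to its neighbour x + 1, only the
-- vertex x − r leaves the ball and only x + 1 + r enters it.  So an identifying code must
-- contain one of these two vertices.  For x < r the first does not exist, which forces
-- x + 1 + r into the code; letting x run over 0, …, r − 1 yields x_{r+2}, …, x_{2r+1}.
-- Symmetrically, at the other end x + 1 + r falls off the path and x − r is forced.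
module Submission where

open import Defs
open import Data.Nat using (ℕ; _≤_; _<_; _+_; _*_; _∸_; zero; suc; z≤n; s≤s; s≤s⁻¹; ∣_-_∣)
open import Data.Nat.Properties
open import Data.Nat.Tactic.RingSolver using (solve)
open import Data.Fin using (Fin; fromℕ<; toℕ)
open import Data.Fin.Properties using (toℕ-injective; toℕ-fromℕ<; toℕ<n)
open import Data.Fin.Subset using (Subset; _∈_)
open import Data.Fin.Subset.Properties using (_∈?_)
open import Data.List using (_∷_; [])
open import Data.Product using (_×_; _,_; ∃; proj₂)
open import Data.Sum using (inj₁; inj₂)
open import Function.Bundles using (_⇔_; mk⇔; Equivalence)
open import Relation.Nullary using (yes; no; contradiction)
open import Relation.Binary.PropositionalEquality

∣x-m∣≤r⇒∣1+x-m∣≤r : ∀ r x m → m + r ≢ x → m ≢ suc (x + r) → ∣ x - m ∣ ≤ r → ∣ suc x - m ∣ ≤ r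
∣x-m∣≤r⇒∣1+x-m∣≤r zero    zero    zero    m+r≢x _ _ = contradiction refl m+r≢x
∣x-m∣≤r⇒∣1+x-m∣≤r (suc r) zero    zero    _     _ _ = s≤s z≤n
∣x-m∣≤r⇒∣1+x-m∣≤r r       (suc x) zero    m+r≢x _ x<r with m≤n⇒m<n∨m≡n x<r
... | inj₁ 1+x<r = 1+x<r
... | inj₂ 1+x≡r = contradiction (sym 1+x≡r) m+r≢x
∣x-m∣≤r⇒∣1+x-m∣≤r r       zero    (suc m) _     _ d≤r = ≤-trans (n≤1+n m) d≤r
∣x-m∣≤r⇒∣1+x-m∣≤r r       (suc x) (suc m) m+r≢x m≢x+r d≤r =
  ∣x-m∣≤r⇒∣1+x-m∣≤r r x m (λ e → m+r≢x (cong suc e)) (λ e → m≢x+r (cong suc e)) d≤r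

∣1+x-m∣≤r⇒∣x-m∣≤r : ∀ r x m → m + r ≢ x → m ≢ suc (x + r) → ∣ suc x - m ∣ ≤ r → ∣ x - m ∣ ≤ r
∣1+x-m∣≤r⇒∣x-m∣≤r r zero    zero    _ _     _   = z≤n
∣1+x-m∣≤r⇒∣x-m∣≤r r (suc x) zero    _ _     d≤r = ≤-trans (n≤1+n (suc x)) d≤r
∣1+x-m∣≤r⇒∣x-m∣≤r r zero    (suc m) _ m≢x+r m<r with m≤n⇒m<n∨m≡n m<r
... | inj₁ 1+m<r = 1+m<r
... | inj₂ m≡r   = contradiction (cong suc m≡r) m≢x+r
∣1+x-m∣≤r⇒∣x-m∣≤r r (suc x) (suc m) m+r≢x m≢x+r d≤r =
  ∣1+x-m∣≤r⇒∣x-m∣≤r r x m (λ e → m+r≢x (cong suc e)) (λ e → m≢x+r (cong suc e)) d≤r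

∣x-m∣≤r⇔∣1+x-m∣≤r : ∀ r x m → m + r ≢ x → m ≢ suc (x + r) → (∣ x - m ∣ ≤ r) ⇔ (∣ suc x - m ∣ ≤ r)
∣x-m∣≤r⇔∣1+x-m∣≤r r x m m+r≢x m≢x+r =
  mk⇔ (∣x-m∣≤r⇒∣1+x-m∣≤r r x m m+r≢x m≢x+r) (∣1+x-m∣≤r⇒∣x-m∣≤r r x m m+r≢x m≢x+r)

module _ {n r : ℕ} {D : Subset n} (code : IsPathIdCode n r D) where

  neighbour-separator-∈ : ∀ x → suc x < n → (c : Fin n) →
    (∀ z → z ≢ c → toℕ z + r ≢ x × toℕ z ≢ suc (x + r)) → c ∈ D
  neighbour-separator-∈ x 1+x<n c no-other-separator with c ∈? D
  ... | yes c∈D = c∈D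
  ... | no  c∉D = contradiction same-balls (proj₂ code left right left≢right)
    where
    x<n : x < n
    x<n = <-trans (n<1+n x) 1+x<n
    left right : Fin n
    left  = fromℕ< x<n
    right = fromℕ< 1+x<n
    left≢right : left ≢ right
    left≢right e = 1+n≢n (trans (sym (toℕ-fromℕ< 1+x<n)) (trans (cong toℕ (sym e)) (toℕ-fromℕ< x<n)))
    step : ∀ z → z ∈ D → (∣ x - toℕ z ∣ ≤ r) ⇔ (∣ suc x - toℕ z ∣ ≤ r)
    step z z∈D with no-other-separator z (λ z≡c → c∉D (subst (_∈ D) z≡c z∈D))
    ... | m+r≢x , m≢x+r = ∣x-m∣≤r⇔∣1+x-m∣≤r r x (toℕ z) m+r≢x m≢x+r
    same-balls : ∀ z → z ∈Ball[ pathDist , r , D ] left ⇔ z ∈Ball[ pathDist , r , D ] right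
    same-balls z rewrite toℕ-fromℕ< x<n | toℕ-fromℕ< 1+x<n =
      mk⇔ (λ (z∈D , d≤r) → z∈D , Equivalence.to (step z z∈D) d≤r)
          (λ (z∈D , d≤r) → z∈D , Equivalence.from (step z z∈D) d≤r)

  right-separator-∈ : ∀ x → suc x < n → x < r → (c : Fin n) → toℕ c ≡ suc (x + r) → c ∈ D
  right-separator-∈ x 1+x<n x<r c c≡1+x+r = neighbour-separator-∈ x 1+x<n c λ z z≢c →
      (λ z+r≡x → <⇒≱ x<r (subst (r ≤_) z+r≡x (m≤n+m r (toℕ z))))
    , (λ z≡1+x+r → z≢c (toℕ-injective (trans z≡1+x+r (sym c≡1+x+r))))

  left-separator-∈ : ∀ x → suc x < n → n ≤ suc (x + r) → (c : Fin n) → toℕ c + r ≡ x → c ∈ D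
  left-separator-∈ x 1+x<n n≤1+x+r c c+r≡x = neighbour-separator-∈ x 1+x<n c λ z z≢c →
      (λ z+r≡x → z≢c (toℕ-injective (+-cancelʳ-≡ r (toℕ z) (toℕ c) (trans z+r≡x (sym c+r≡x)))))
    , (λ z≡1+x+r → <⇒≱ (toℕ<n z) (subst (n ≤_) (sym z≡1+x+r) n≤1+x+r))

m<o∸n⇒m+n<o : ∀ m {n o} → m < o ∸ n → m + n < o
m<o∸n⇒m+n<o m {n} {o} m<o∸n = m≤o∸n⇒m+n≤o (suc m) (<⇒≤ n<o) m<o∸n
  where
  n<o : n < o
  n<o = m∸n≢0⇒n<m (λ o∸n≡0 → <⇒≢ (≤-<-trans z≤n m<o∸n) (sym o∸n≡0))

lower-block-centre : ∀ r k → r + 2 ≤ k + 1 → k + 1 ≤ 2 * r + 1 → ∃ λ x → x < r × suc (x + r) ≡ k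
lower-block-centre r k lo hi with m≤n⇒∃[o]m+o≡n (s≤s⁻¹ (subst₂ _≤_ (+-comm r 2) (+-comm k 1) lo))
... | x , 1+r+x≡k = x , x<r , 1+x+r≡k
  where
  1+x+r≡k : suc (x + r) ≡ k
  1+x+r≡k = trans (cong suc (+-comm x r)) 1+r+x≡k
  x<r : x < r
  x<r = +-cancelʳ-≤ r (suc x) r (begin
    suc (x + r) ≡⟨ 1+x+r≡k ⟩
    k           ≤⟨ +-cancelʳ-≤ 1 k (2 * r) hi ⟩
    2 * r       ≡⟨ solve (r ∷ []) ⟩
    r + r       ∎)
    where open ≤-Reasoning

upper-block-centre : ∀ n r k → n ∸ 2 * r ≤ k + 1 → k + 1 ≤ n ∸ r ∸ 1 →
  suc (k + r) < n × n ≤ suc (k + r + r)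
upper-block-centre n r k lo hi = 1+k+r<n , n≤1+k+r+r
  where
  1+k+r<n : suc (k + r) < n
  1+k+r<n = subst (_< n) k+1+r≡1+k+r
    (m<o∸n⇒m+n<o (k + 1) (m<o∸n⇒m+n<o k (subst (_≤ n ∸ r ∸ 1) (+-comm k 1) hi)))
    where
    k+1+r≡1+k+r : k + 1 + r ≡ suc (k + r)
    k+1+r≡1+k+r = solve (k ∷ r ∷ [])
  n≤1+k+r+r : n ≤ suc (k + r + r)
  n≤1+k+r+r = begin
    n                   ≤⟨ m≤n+m∸n n (2 * r) ⟩
    2 * r + (n ∸ 2 * r) ≤⟨ +-monoʳ-≤ (2 * r) lo ⟩
    2 * r + (k + 1)     ≡⟨ solve (k ∷ r ∷ []) ⟩
    suc (k + r + r)     ∎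
    where open ≤-Reasoning

lemma9 : (r n : ℕ) → 1 ≤ r → 2 * r + 1 ≤ n → (D : Subset n) → IsPathIdCode n r D →
    ((k : ℕ) → (k<n : k < n) → r + 2 ≤ k + 1 → k + 1 ≤ 2 * r + 1 → fromℕ< k<n ∈ D)
    × ((k : ℕ) → (k<n : k < n) → n ∸ 2 * r ≤ k + 1 → k + 1 ≤ n ∸ r ∸ 1 → fromℕ< k<n ∈ D)
lemma9 r n _ _ D code = lower-block , upper-block
  where
  lower-block : (k : ℕ) → (k<n : k < n) → r + 2 ≤ k + 1 → k + 1 ≤ 2 * r + 1 → fromℕ< k<n ∈ D
  lower-block k k<n lo hi with lower-block-centre r k lo hi
  ... | x , x<r , 1+x+r≡k =
    right-separator-∈ code x 1+x<n x<r (fromℕ< k<n) (trans (toℕ-fromℕ< k<n) (sym 1+x+r≡k))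
    where
    1+x<n : suc x < n
    1+x<n = ≤-<-trans (subst (suc x ≤_) 1+x+r≡k (s≤s (m≤m+n x r))) k<n
  upper-block : (k : ℕ) → (k<n : k < n) → n ∸ 2 * r ≤ k + 1 → k + 1 ≤ n ∸ r ∸ 1 → fromℕ< k<n ∈ D
  upper-block k k<n lo hi with upper-block-centre n r k lo hi
  ... | 1+k+r<n , n≤1+k+r+r =
    left-separator-∈ code (k + r) 1+k+r<n n≤1+k+r+r (fromℕ< k<n) (cong (_+ r) (toℕ-fromℕ< k<n))
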